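{- The family of $\mathcal G_t$-networks (with bounded-degree representation) is not universal.
   Context: $\mathcal G$-networks. Let $Q$ be a finite alphabet and $\mathcal G$ a set of maps $g:Q^{i(g)}\to Q^{o(g)}$. A $\mathcal G$-network is an automata network $F:Q^V\to Q^V$ together with gates $g_1,\dots,g_n\in\mathcal G$ such that, with $I=\{(j,k):1\le k\le i(g_j)\}$ and $O=\{(j,k):1\le k\le o(g_j)\}$, $|V|=|I|=|O|$ and there are bijections $\alpha:I\to V$, $\beta:V\to O$ with no $(j,k)\in I$ satisfying $\beta(\alpha(j,k))=(j,k')$ for some $k'$, and for $v$ with $\beta(v)=(j,k)$: $F(x)_v=g_j(x_{\alpha(j,1)},\dots,x_{\alpha(j,i(g_j))})_k$. The family is represented by interaction graph plus local transition tables. $\mathcal G_t$: alphabet $Q=\{0,1,2\}$ and the maps $\mathrm{AND}_{\{0,1\}}(x,y)=2$ if $2\in\{x,y\}$ and $x\wedge y$ otherwise; $\mathrm{AND}_2(x,y)=2$ if $2\in\{x,y\}$ or $x=y=1$, and $0$ otherwise; $\Lambda(x,y)=2$ if $2\in\{x,y\}$ and $x$ otherwise; $\mathrm{Id}(x)=x$; $\Upsilon(x)=(x,x)$. Universality. For each finite alphabet fix an injective $m_Q:Q\to\{0,1\}^{k_Q}$ extended cellwise; a circuit encoding of $F:Q^n\to Q^n$ is a Boolean circuit $C$ with $m_Q\circ F=C\circ m_Q$. A standard representation of a family is a language with a logarithmic-space algorithm producing a circuit encoding of a member from each word, all members represented. A block embedding of $Q_F^{V_F}$ into $Q_G^{V_G}$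 is a partition $(D_i)_{i\in V_F}$ of $V_G$ with patterns $p_{i,q}\in Q_G^{D_i}$ injective in $q$, giving $\phi(x)|_{D_i}=p_{i,x_i}$; $G$ simulates $F$ via $\phi$ with time constant $T$ if $\phi\circ F=G^T\circ\phi$. A family $(\mathcal F,\mathcal F^*)$ simulates $(\mathcal H,\mathcal H^*)$ in time $T$ and space $S$ if a logarithmic-space Turing machine maps each word representing $H:Q_H^n\to Q_H^n$ to a word representing $F\in\mathcal F$ on $S(n)$ nodes, the number $T(n)$ and a block embedding via which $F$ simulates $H$ with time constant $T(n)$. $\mathcal U_{Q,P}$ ($P$ polynomial) is the family of all $F:Q^n\to Q^n$ with a circuit encoding of size $\le P(n)$, represented by such circuits; a family is universal if for every finite $Q$ and polynomial $P$ it simulates $\mathcal U_{Q,P}$ in polynomial time and polynomial space. -}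

module Defs where

open import Data.Nat using (ℕ; zero; suc; _+_; _*_; _^_; _≤_; _<_; _≤?_; _≟_)
open import Relation.Nullary using (yes; no)
open import Data.Nat.Logarithm using (⌊log₂_⌋)
open import Data.Digit using (toNatDigits)
open import Data.Fin as Fin using (Fin; toℕ)
open import Data.Bool using (Bool; true; false; if_then_else_; _∧_; _∨_; not)
open import Data.List using (List; []; _∷_; _++_; _∷ʳ_; map; length; allFin; concat; foldl)
open import Data.List.Relation.Unary.All using (All)
open import Data.List.Relation.Unary.Linked using (Linked)
open import Data.List.Membership.Propositional using (_∈_)
open import Data.Vec as Vec using (Vec)
open import Data.Maybe using (Maybe; just; nothing)
open import Data.Product using (Σ; Σ-syntax; ∃; ∃-syntax; _×_; _,_; proj₁; proj₂)
open import Data.Unit using (⊤)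
open import Function using (_∘_; id)
open import Function.Bundles using (_⤖_; Bijection)
open import Relation.Binary.PropositionalEquality using (_≡_; _≢_)

nth : {A : Set} → List A → ℕ → Maybe A
nth []       _       = nothing
nth (a ∷ as) zero    = just a
nth (a ∷ as) (suc i) = nth as i

nthD : {A : Set} → A → List A → ℕ → A
nthD d []       _       = d
nthD d (a ∷ as) zero    = a
nthD d (a ∷ as) (suc i) = nthD d as i

iter : {A : Set} → ℕ → (A → A) → A → A
iter zero    f a = a
iter (suc t) f a = iter t f (f a)

-- configurations of an automata network on n nodes over the alphabet Fin q
Cfg : ℕ → ℕ → Set
Cfg q n = Fin n → Fin q

-- polynomials with natural coefficients (constant coefficient first)
Poly : Set
Poly = List ℕ

evalPoly : Poly → ℕ → ℕ
evalPoly []       x = 0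
evalPoly (c ∷ cs) x = c + x * evalPoly cs x

PolyBounded : (ℕ → ℕ) → Set
PolyBounded f = Σ[ P ∈ Poly ] (∀ n → f n ≤ evalPoly P n)

-- Words: a fixed 5-letter alphabet  0 1 ( ) ,  and structured data
-- (trees of natural numbers in binary) encoded as words over it.

Tok : Set
Tok = Fin 5

t0 t1 tOpen tClose tComma : Tok
t0 = Fin.zero
t1 = Fin.suc Fin.zero
tOpen = Fin.suc (Fin.suc Fin.zero)
tClose = Fin.suc (Fin.suc (Fin.suc Fin.zero))
tComma = Fin.suc (Fin.suc (Fin.suc (Fin.suc Fin.zero)))

digitTok : ℕ → Tok
digitTok zero    = t0
digitTok (suc _) = t1

-- binary notation (most significant digit first, "0" for zero)
bits : ℕ → List Tok
bits n = map digitTok (toNatDigits 2 n)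

data Tree : Set where
  leaf : ℕ → Tree
  node : List Tree → Tree

mutual
  enc : Tree → List Tok
  enc (leaf n)  = bits n
  enc (node ts) = tOpen ∷ encs ts

  encs : List Tree → List Tok
  encs []       = tClose ∷ []
  encs (t ∷ ts) = enc t ++ sep ts

  sep : List Tree → List Tok
  sep []       = tClose ∷ []
  sep (t ∷ ts) = tComma ∷ (enc t ++ sep ts)

-- Logarithmic-space Turing transducers: two-way read-only input tape
-- with endmarkers, one work tape, one-way write-only output tape.

data Move : Set where
  L S R : Move

data InSym : Set where
  lend : InSym
  sym  : Tok → InSym
  rend : InSym

record TM : Set where
  field
    nSt    : ℕ
    nWk    : ℕ                                   -- work alphabet Fin (suc nWk), blank = zero
    start  : Fin nSt
    isHalt : Fin nSt → Bool
    δ      : Fin nSt → InSym → Fin (suc nWk) →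
             Fin nSt × Fin (suc nWk) × Move × Move × Maybe Tok
             -- new state, written work symbol, input move, work move, output

record Config (M : TM) : Set where
  constructor cfg
  field
    st   : Fin (TM.nSt M)
    ih   : ℕ                                      -- input head (0 = left endmarker)
    wh   : ℕ
    tape : ℕ → Fin (suc (TM.nWk M))
    out  : List Tok

readIn : List Tok → ℕ → InSym
readIn w zero = lend
readIn w (suc i) with nth w i
... | just a  = sym a
... | nothing = rend

moveIn : List Tok → Move → ℕ → ℕ
moveIn w L zero    = zero
moveIn w L (suc i) = i
moveIn w S i       = i
moveIn w R i with suc i ≤? suc (length w)
... | yes _ = suc i
... | no  _ = i

moveWk : Move → ℕ → ℕ
moveWk L zero    = zero
moveWk L (suc i) = i
moveWk S i       = i
moveWk R i       = suc i

writeTape : {A : Set} → (ℕ → A) → ℕ → A → ℕ → A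
writeTape f i a j with i ≟ j
... | yes _ = a
... | no  _ = f j

addOut : Maybe Tok → List Tok → List Tok
addOut nothing  o = o
addOut (just a) o = o ∷ʳ a

step : (M : TM) → List Tok → Config M → Config M
step M w c@(cfg s i h tp o) with TM.isHalt M s
... | true  = c
... | false with TM.δ M s (readIn w i) (tp h)
...   | (s' , a , mi , mw , ot) = cfg s' (moveIn w mi i) (moveWk mw h) (writeTape tp h a) (addOut ot o)

initCfg : (M : TM) → Config M
initCfg M = cfg (TM.start M) 0 0 (λ _ → Fin.zero) []

run : (M : TM) → List Tok → ℕ → Config M
run M w t = iter t (step M w) (initCfg M)

Computes : TM → List Tok → List Tok → Set
Computes M w o = Σ[ t ∈ ℕ ] (TM.isHalt M (Config.st (run M w t)) ≡ true × Config.out (run M w t) ≡ o)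

SpaceBound : TM → ℕ → List Tok → Set
SpaceBound M c w = ∀ t → Config.wh (run M w t) ≤ c * ⌊log₂ (length w) ⌋ + c

data Gate : Set where
  andG orG : ℕ → ℕ → Gate
  notG     : ℕ → Gate

record Circuit : Set where
  field
    nIn   : ℕ
    gates : List Gate
    outs  : List ℕ

evalGate : List Bool → Gate → Bool
evalGate ws (andG i j) = nthD false ws i ∧ nthD false ws j
evalGate ws (orG i j)  = nthD false ws i ∨ nthD false ws j
evalGate ws (notG i)   = not (nthD false ws i)

wires : List Bool → List Gate → List Bool
wires ws []       = ws
wires ws (g ∷ gs) = wires (ws ∷ʳ evalGate ws g) gs

evalC : Circuit → List Bool → List Bool
evalC C x = map (nthD false (wires x (Circuit.gates C))) (Circuit.outs C)

-- every gate only reads earlier wires (wires 0 .. k-1 exist before gate k)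
GateWF : ℕ → Gate → Set
GateWF k (andG i j) = i < k × j < k
GateWF k (orG i j)  = i < k × j < k
GateWF k (notG i)   = i < k

GatesWF : ℕ → List Gate → Set
GatesWF k []       = ⊤
GatesWF k (g ∷ gs) = GateWF k g × GatesWF (suc k) gs

CircuitWF : Circuit → Set
CircuitWF C = GatesWF (Circuit.nIn C) (Circuit.gates C)
            × All (_< Circuit.nIn C + length (Circuit.gates C)) (Circuit.outs C)
            × length (Circuit.outs C) ≡ Circuit.nIn C

size : Circuit → ℕ
size C = length (Circuit.gates C)

gateTree : Gate → Tree
gateTree (andG i j) = node (leaf 0 ∷ leaf i ∷ leaf j ∷ [])
gateTree (orG i j)  = node (leaf 1 ∷ leaf i ∷ leaf j ∷ [])
gateTree (notG i)   = node (leaf 2 ∷ leaf i ∷ [])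

circTree : Circuit → Tree
circTree C = node (leaf (Circuit.nIn C) ∷ node (map gateTree (Circuit.gates C))
                   ∷ node (map leaf (Circuit.outs C)) ∷ [])

-- Circuit encodings and the family U_{Q,P}.
-- k q : code length and  m q : Fin q → {0,1}^{k q}  the fixed injective coding

module _ (k : ℕ → ℕ) (m : (q : ℕ) → Fin q → Vec Bool (k q)) where

  mEnc : {q n : ℕ} → Cfg q n → List Bool
  mEnc {q} {n} x = concat (map (λ i → Vec.toList (m q (x i))) (allFin n))

  IsCircuitEncoding : {q n : ℕ} → (Cfg q n → Cfg q n) → Circuit → Set
  IsCircuitEncoding {q} {n} H C =
    CircuitWF C × Circuit.nIn C ≡ k q * n × (∀ x → evalC C (mEnc x) ≡ mEnc (H x))

  -- the word w represents H : Q^n → Q^n as a member of U_{Q,P}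
  RepU : (q : ℕ) → Poly → (n : ℕ) → (Cfg q n → Cfg q n) → List Tok → Set
  RepU q P n H w = Σ[ C ∈ Circuit ] (IsCircuitEncoding H C × size C ≤ evalPoly P n × w ≡ enc (circTree C))

Q3 : Set
Q3 = Fin 3

q0 q1 q2 : Q3
q0 = Fin.zero
q1 = Fin.suc Fin.zero
q2 = Fin.suc (Fin.suc Fin.zero)

isTwo : Q3 → Bool
isTwo (Fin.suc (Fin.suc Fin.zero)) = true
isTwo _ = false

data GtGate : Set where
  AND01 AND2 Λ IdG Υ : GtGate

inAr : GtGate → ℕ
inAr AND01 = 2
inAr AND2  = 2
inAr Λ     = 2
inAr IdG   = 1
inAr Υ     = 1

outAr : GtGate → ℕ
outAr AND01 = 1
outAr AND2  = 1
outAr Λ     = 1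
outAr IdG   = 1
outAr Υ     = 2

and01 : Q3 → Q3 → Q3
and01 x y = if isTwo x ∨ isTwo y then q2 else andB x y
  where
  andB : Q3 → Q3 → Q3
  andB (Fin.suc Fin.zero) (Fin.suc Fin.zero) = q1
  andB _ _ = q0

and2 : Q3 → Q3 → Q3
and2 x y = if isTwo x ∨ isTwo y then q2 else both x y
  where
  both : Q3 → Q3 → Q3
  both (Fin.suc Fin.zero) (Fin.suc Fin.zero) = q2
  both _ _ = q0

lam : Q3 → Q3 → Q3
lam x y = if isTwo x ∨ isTwo y then q2 else x

fst2 snd2 : Fin 2
fst2 = Fin.zero
snd2 = Fin.suc Fin.zero

gtEval : (g : GtGate) → (Fin (inAr g) → Q3) → Fin (outAr g) → Q3
gtEval AND01 x _ = and01 (x fst2) (x snd2)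
gtEval AND2  x _ = and2 (x fst2) (x snd2)
gtEval Λ     x _ = lam (x fst2) (x snd2)
gtEval IdG   x _ = x Fin.zero
gtEval Υ     x _ = x Fin.zero

IsGtNetwork : (N : ℕ) → (Cfg 3 N → Cfg 3 N) → Set
IsGtNetwork N F =
  Σ[ r ∈ ℕ ] Σ[ g ∈ (Fin r → GtGate) ]
  Σ[ α ∈ ((Σ[ j ∈ Fin r ] Fin (inAr (g j))) ⤖ Fin N) ]
  Σ[ β ∈ (Fin N ⤖ (Σ[ j ∈ Fin r ] Fin (outAr (g j)))) ]
    ( (∀ (j : Fin r) (kk : Fin (inAr (g j))) →
         proj₁ (Bijection.to β (Bijection.to α (j , kk))) ≢ j)
    × (∀ x v → F x v ≡ gtEval (g (proj₁ (Bijection.to β v)))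
                                (λ kk → x (Bijection.to α (proj₁ (Bijection.to β v) , kk)))
                                (proj₂ (Bijection.to β v))) )

Depends : {q N : ℕ} → (Cfg q N → Cfg q N) → Fin N → Fin N → Set
Depends {q} {N} F v u =
  Σ[ x ∈ Cfg q N ] Σ[ y ∈ Cfg q N ] ((∀ w → w ≢ u → x w ≡ y w) × F x v ≢ F y v)

-- for each node: (increasing list of in-neighbours, local transition table)
Desc : ℕ → Set
Desc N = Fin N → List (Fin N) × List Q3

-- index of a tuple of states in lexicographic order
tupleIndex : List Q3 → ℕ
tupleIndex = foldl (λ acc a → 3 * acc + toℕ a) 0

descF : {N : ℕ} → Desc N → Cfg 3 N → Cfg 3 N
descF D x v = nthD q0 (proj₂ (D v)) (tupleIndex (map x (proj₁ (D v))))

DescWF : (N : ℕ) → Desc N → Set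
DescWF N D = ∀ v →
    Linked Fin._<_ (proj₁ (D v))
  × (∀ u → (u ∈ proj₁ (D v) → Depends (descF D) v u) × (Depends (descF D) v u → u ∈ proj₁ (D v)))
  × length (proj₂ (D v)) ≡ 3 ^ length (proj₁ (D v))

descTree : (N : ℕ) → Desc N → Tree
descTree N D = node (leaf N ∷ node (map nodeT (allFin N)) ∷ [])
  where
  nodeT : Fin N → Tree
  nodeT v = node (node (map (leaf ∘ toℕ) (proj₁ (D v))) ∷ node (map (leaf ∘ toℕ) (proj₂ (D v))) ∷ [])

-- Block embeddings of (Fin q)^(Fin n) into (Fin 3)^(Fin N) and simulation.
-- blk v = the index i of the block D_i containing v; the pattern p_{i,a}
-- is  pat a  restricted to D_i.

IsBlockEmbedding : (q n N : ℕ) → (Fin N → Fin n) → (Fin q → Fin N → Q3) → Set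
IsBlockEmbedding q n N blk pat =
    (∀ i → Σ[ v ∈ Fin N ] blk v ≡ i)
  × (∀ i a b → (∀ v → blk v ≡ i → pat a v ≡ pat b v) → a ≡ b)

φ : {q n N : ℕ} → (Fin N → Fin n) → (Fin q → Fin N → Q3) → Cfg q n → Cfg 3 N
φ blk pat x v = pat (x (blk v)) v

embTree : (q n N : ℕ) → (Fin N → Fin n) → (Fin q → Fin N → Q3) → Tree
embTree q n N blk pat =
  node (node (map (leaf ∘ toℕ ∘ blk) (allFin N))
        ∷ node (map (λ a → node (map (leaf ∘ toℕ ∘ pat a) (allFin N))) (allFin q)) ∷ [])

Simulates : {q n N : ℕ} → (Cfg 3 N → Cfg 3 N) → (Cfg q n → Cfg q n) →
            (Fin N → Fin n) → (Fin q → Fin N → Q3) → ℕ → Set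
Simulates G H blk pat T = ∀ x v → φ blk pat (H x) v ≡ iter T G (φ blk pat x) v

module _ (k : ℕ → ℕ) (m : (q : ℕ) → Fin q → Vec Bool (k q)) where

  GtSimulatesU : (q : ℕ) → Poly → Set
  GtSimulatesU q P =
    Σ[ M ∈ TM ] Σ[ c ∈ ℕ ] Σ[ T ∈ (ℕ → ℕ) ] Σ[ Sp ∈ (ℕ → ℕ) ]
      ( PolyBounded T × PolyBounded Sp
      × (∀ n (H : Cfg q n → Cfg q n) (w : List Tok) → RepU k m q P n H w →
           SpaceBound M c w
           × Σ[ D ∈ Desc (Sp n) ] Σ[ blk ∈ (Fin (Sp n) → Fin n) ] Σ[ pat ∈ (Fin q → Fin (Sp n) → Q3) ]
               ( DescWF (Sp n) D × IsGtNetwork (Sp n) (descF D)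
               × IsBlockEmbedding q n (Sp n) blk pat
               × Simulates (descF D) H blk pat (T n)
               × Computes M w (enc (node (descTree (Sp n) D ∷ leaf (T n) ∷ embTree q n (Sp n) blk pat ∷ [])))) ) )

  GtUniversal : Set
  GtUniversal = ∀ (q : ℕ) (P : Poly) → GtSimulatesU q P

-- A relation on {0,1,2} that is preserved by AND_{0,1}, AND_2 and Λ (Id and Υ preserve
-- every relation) holds columnwise at all times in a G_t-network once it holds initially,
-- and is therefore carried through any simulation.  The two-cell network
-- (a , b) ↦ (a ⊕ b , b) has a circuit encoding of size 7 for every injective coding: it
-- compares the two cells at a bit where the codes of 0 and 1 differ.  Run a simulating
-- G_t-network on the inputs 00, 01, 10, 11.  At a node of the first cell's block with
-- patterns p₀, p₁ the column (p₀, p₀, p₁, p₁) turns into (p₀, p₁, p₁, p₀).  A first pass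
-- with the invariant R₁ shows that R₂ holds on the initial columns; a second pass with R₂
-- then forces p₀ = p₁ on the whole block, against injectivity of the block embedding.

module Submission where

open import Defs hiding (sym; L; S; R)
open import Data.Nat using (ℕ; zero; suc; _+_; _*_; _<_; z<s)
open import Data.Nat.Properties
  using (≤-refl; n≤1+n; m<n⇒m<1+n; m≤m+n; <-≤-trans; +-monoʳ-<; +-monoˡ-<; +-comm; +-assoc; +-identityʳ; *-comm)
open import Data.Fin using (Fin; zero; suc; toℕ; #_)
open import Data.Fin.Properties using (toℕ<n; all?; ¬∀⟶∃¬; 0≢1+n)
import Data.Fin.Properties as Fin
open import Data.Bool using (Bool; true; false; _∧_; _∨_; not; _xor_; if_then_else_; T)
open import Data.Bool.Properties using (xor-is-ok; xor-same; ∧-inverseʳ)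
import Data.Bool.Properties as Bool
open import Data.Vec using (Vec; []; _∷_; map; zipWith; lookup; toList; tabulate)
open import Data.Vec.Properties using (map-∘; map-cong; map-id; tabulate∘lookup; tabulate-cong; length-toList)
open import Data.List as List using (List; []; _∷_; _++_; _∷ʳ_; applyUpTo)
open import Data.List.Properties using (++-assoc; ++-identityʳ; length-++; map-++; length-applyUpTo; map-applyUpTo)
open import Data.List.Relation.Unary.All using (All; []; _∷_)
open import Data.List.Relation.Unary.All.Properties using (++⁺; applyUpTo⁺₁)
open import Data.Product using (∃; _,_; proj₁; proj₂)
open import Data.Unit using (tt)
open import Data.Empty using (⊥; ⊥-elim)
open import Function using (_∘_)
open import Function.Definitions using (Injective)
open import Function.Bundles using (Bijection)
open import Relation.Binary.PropositionalEquality
  using (_≡_; _≢_; refl; sym; trans; cong; cong₂; subst; module ≡-Reasoning)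
open import Relation.Nullary using (¬_; Dec)
open import Relation.Nullary.Decidable using (map′; _→-dec_; T?; from-yes; ⌊_⌋)

open ≡-Reasoning

pattern 0F = zero
pattern 1F = suc zero

Relation : ℕ → Set₁
Relation n = Vec Q3 n → Set

Preserves : {n : ℕ} → Relation n → (Q3 → Q3 → Q3) → Set
Preserves R f = ∀ a b → R a → R b → R (zipWith f a b)

record GtInvariant {n : ℕ} (R : Relation n) : Set where
  field
    and01-preserves : Preserves R and01
    and2-preserves  : Preserves R and2
    lam-preserves   : Preserves R lam

zipWith-map-map : {A B C D : Set} {n : ℕ} (f : B → C → D) (g : A → B) (h : A → C) (xs : Vec A n) →
                  zipWith f (map g xs) (map h xs) ≡ map (λ x → f (g x) (h x)) xs
zipWith-map-map f g h []       = refl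
zipWith-map-map f g h (x ∷ xs) = cong (f (g x) (h x) ∷_) (zipWith-map-map f g h xs)

gtEval-preserves : {n : ℕ} {R : Relation n} → GtInvariant R →
                   (g : GtGate) (xs : Vec (Fin (inAr g) → Q3) n) (o : Fin (outAr g)) →
                   (∀ i → R (map (λ x → x i) xs)) → R (map (λ x → gtEval g x o) xs)
gtEval-preserves {n} {R} inv = go
  where
  open GtInvariant inv

  binary : {f : Q3 → Q3 → Q3} → Preserves R f → (xs : Vec (Fin 2 → Q3) n) →
           (∀ i → R (map (λ x → x i) xs)) → R (map (λ x → f (x fst2) (x snd2)) xs)
  binary {f} pres xs hyp =
    subst R (zipWith-map-map f _ _ xs) (pres _ _ (hyp fst2) (hyp snd2))

  go : (g : GtGate) (xs : Vec (Fin (inAr g) → Q3) n) (o : Fin (outAr g)) →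
       (∀ i → R (map (λ x → x i) xs)) → R (map (λ x → gtEval g x o) xs)
  go AND01 xs o hyp = binary and01-preserves xs hyp
  go AND2  xs o hyp = binary and2-preserves xs hyp
  go Λ     xs o hyp = binary lam-preserves xs hyp
  go IdG   xs o hyp = hyp zero
  go Υ     xs o hyp = hyp zero

column : {A : Set} {n N : ℕ} → Vec (Fin N → A) n → Fin N → Vec A n
column ys v = map (λ y → y v) ys

Columnwise : {n N : ℕ} → Relation n → Vec (Cfg 3 N) n → Set
Columnwise R ys = ∀ v → R (column ys v)

network-step-preserves : {N n : ℕ} {F : Cfg 3 N → Cfg 3 N} {R : Relation n} →
                         IsGtNetwork N F → GtInvariant R →
                         ∀ ys → Columnwise R ys → Columnwise R (map F ys)
network-step-preserves {N} {F = F} {R} (r , g , α , β , _ , F-local) inv ys hold v =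
  subst R (sym column-F) (gtEval-preserves inv (g j) (map inputs ys) o input-columns)
  where
  j : Fin r
  j = proj₁ (Bijection.to β v)

  o : Fin (outAr (g j))
  o = proj₂ (Bijection.to β v)

  inputs : Cfg 3 N → Fin (inAr (g j)) → Q3
  inputs y i = y (Bijection.to α (j , i))

  input-columns : ∀ i → R (map (λ x → x i) (map inputs ys))
  input-columns i = subst R (map-∘ (λ x → x i) inputs ys) (hold (Bijection.to α (j , i)))

  column-F : column (map F ys) v ≡ map (λ x → gtEval (g j) x o) (map inputs ys)
  column-F = begin
    map (λ y → y v) (map F ys)                ≡⟨ map-∘ (λ y → y v) F ys ⟨
    map (λ y → F y v) ys                      ≡⟨ map-cong (λ y → F-local y v) ys ⟩
    map (λ y → gtEval (g j) (inputs y) o) ys  ≡⟨ map-∘ (λ x → gtEval (g j) x o) inputs ys ⟩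
    map (λ x → gtEval (g j) x o) (map inputs ys) ∎

iter-preserves : {N n : ℕ} {F : Cfg 3 N → Cfg 3 N} {R : Relation n} →
                 IsGtNetwork N F → GtInvariant R →
                 ∀ t ys → Columnwise R ys → Columnwise R (map (iter t F) ys)
iter-preserves {R = R} net inv zero ys hold = subst (Columnwise R) (sym (map-id ys)) hold
iter-preserves {F = F} {R} net inv (suc t) ys hold =
  subst (Columnwise R) (sym (map-∘ (iter t F) F ys))
        (iter-preserves net inv t (map F ys) (network-step-preserves net inv ys hold))

simulation-preserves : {q n N r : ℕ} {G : Cfg 3 N → Cfg 3 N} {H : Cfg q n → Cfg q n}
                       {blk : Fin N → Fin n} {pat : Fin q → Fin N → Q3} {T : ℕ} {R : Relation r} →
                       IsGtNetwork N G → GtInvariant R → Simulates G H blk pat T →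
                       ∀ xs → Columnwise R (map (φ blk pat) xs) → Columnwise R (map (φ blk pat ∘ H) xs)
simulation-preserves {G = G} {H} {blk} {pat} {T} {R} net inv sim xs hold v =
  subst R (sym column-H) (iter-preserves net inv T (map (φ blk pat) xs) hold v)
  where
  column-H : column (map (φ blk pat ∘ H) xs) v ≡ column (map (iter T G) (map (φ blk pat) xs)) v
  column-H = begin
    map (λ y → y v) (map (φ blk pat ∘ H) xs)            ≡⟨ map-∘ (λ y → y v) (φ blk pat ∘ H) xs ⟨
    map (λ x → φ blk pat (H x) v) xs                    ≡⟨ map-cong (λ x → sim x v) xs ⟩
    map (λ x → iter T G (φ blk pat x) v) xs             ≡⟨ map-∘ (λ y → iter T G y v) (φ blk pat) xs ⟩
    map (λ y → iter T G y v) (map (φ blk pat) xs)       ≡⟨ map-∘ (λ y → y v) (iter T G) (map (φ blk pat) xs) ⟩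
    map (λ y → y v) (map (iter T G) (map (φ blk pat) xs)) ∎

all-Vec? : {q : ℕ} (n : ℕ) {P : Vec (Fin q) n → Set} → (∀ xs → Dec (P xs)) → Dec (∀ xs → P xs)
all-Vec? zero    P? = map′ (λ p → λ { [] → p }) (λ p → p []) (P? [])
all-Vec? (suc n) P? =
  map′ (λ p → λ { (x ∷ xs) → p x xs }) (λ p x xs → p (x ∷ xs)) (all? λ x → all-Vec? n (λ xs → P? (x ∷ xs)))

preserves? : {n : ℕ} (R : Vec Q3 n → Bool) (f : Q3 → Q3 → Q3) → Dec (Preserves (T ∘ R) f)
preserves? {n} R f =
  all-Vec? n λ a → all-Vec? n λ b → T? (R a) →-dec T? (R b) →-dec T? (R (zipWith f a b))

_⊕_ : Fin 2 → Fin 2 → Fin 2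
0F ⊕ b  = b
1F ⊕ 0F = 1F
1F ⊕ 1F = 0F

xorNetwork : Cfg 2 2 → Cfg 2 2
xorNetwork x 0F = x 0F ⊕ x 1F
xorNetwork x 1F = x 1F

pairCfg : Fin 2 → Fin 2 → Cfg 2 2
pairCfg a b 0F = a
pairCfg a b 1F = b

isZero isOne : Q3 → Bool
isZero 0F = true
isZero _  = false
isOne 1F = true
isOne _  = false

-- Coordinates are indexed by the inputs 00, 01, 10, 11 of the xor network.
R₁ : Vec Q3 4 → Bool
R₁ (a ∷ b ∷ c ∷ d ∷ []) = not (blocked a d b c ∨ blocked b c a d)
  where
  blocked : Q3 → Q3 → Q3 → Q3 → Bool
  blocked x y z w = (isOne x ∧ isOne y) ∧ (isZero z ∨ isZero w)

-- Independence of the first cell, unless one half has saturated to 2.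
R₂ : Vec Q3 4 → Bool
R₂ (a ∷ b ∷ c ∷ d ∷ []) = (⌊ a Fin.≟ c ⌋ ∧ ⌊ b Fin.≟ d ⌋) ∨ (isTwo c ∧ isTwo d) ∨ (isTwo a ∧ isTwo b)

R₁-invariant : GtInvariant (T ∘ R₁)
R₁-invariant = record
  { and01-preserves = from-yes (preserves? R₁ and01)
  ; and2-preserves  = from-yes (preserves? R₁ and2)
  ; lam-preserves   = from-yes (preserves? R₁ lam)
  }

R₂-invariant : GtInvariant (T ∘ R₂)
R₂-invariant = record
  { and01-preserves = from-yes (preserves? R₂ and01)
  ; and2-preserves  = from-yes (preserves? R₂ and2)
  ; lam-preserves   = from-yes (preserves? R₂ lam)
  }

R₁-sstt : ∀ s t → T (R₁ (s ∷ s ∷ t ∷ t ∷ []))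
R₁-sstt = from-yes (all? λ s → all? λ t → T? (R₁ (s ∷ s ∷ t ∷ t ∷ [])))

R₁-stst : ∀ s t → T (R₁ (s ∷ t ∷ s ∷ t ∷ []))
R₁-stst = from-yes (all? λ s → all? λ t → T? (R₁ (s ∷ t ∷ s ∷ t ∷ [])))

R₂-stst : ∀ s t → T (R₂ (s ∷ t ∷ s ∷ t ∷ []))
R₂-stst = from-yes (all? λ s → all? λ t → T? (R₂ (s ∷ t ∷ s ∷ t ∷ [])))

R₁-stts⇒R₂-sstt : ∀ s t → T (R₁ (s ∷ t ∷ t ∷ s ∷ [])) → T (R₂ (s ∷ s ∷ t ∷ t ∷ []))
R₁-stts⇒R₂-sstt =
  from-yes (all? λ s → all? λ t → T? (R₁ (s ∷ t ∷ t ∷ s ∷ [])) →-dec T? (R₂ (s ∷ s ∷ t ∷ t ∷ [])))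

R₂-stts⇒≡ : ∀ s t → T (R₂ (s ∷ t ∷ t ∷ s ∷ [])) → s ≡ t
R₂-stts⇒≡ = from-yes (all? λ s → all? λ t → T? (R₂ (s ∷ t ∷ t ∷ s ∷ [])) →-dec s Fin.≟ t)

module _ {N : ℕ} {G : Cfg 3 N → Cfg 3 N} {blk : Fin N → Fin 2} {pat : Fin 2 → Fin N → Q3} {t : ℕ}
         (net : IsGtNetwork N G) (sim : Simulates G xorNetwork blk pat t) where

  xor-propagates : {R : Relation 4} → GtInvariant R →
                   (∀ v → blk v ≡ 0F → R (pat 0F v ∷ pat 0F v ∷ pat 1F v ∷ pat 1F v ∷ [])) →
                   (∀ v → blk v ≡ 1F → R (pat 0F v ∷ pat 1F v ∷ pat 0F v ∷ pat 1F v ∷ [])) →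
                   ∀ v → blk v ≡ 0F → R (pat 0F v ∷ pat 1F v ∷ pat 1F v ∷ pat 0F v ∷ [])
  xor-propagates {R} inv first-cell second-cell v v-in-first =
    subst (λ i → R (map (λ x → pat (xorNetwork x i) v) inputs)) v-in-first
          (simulation-preserves {H = xorNetwork} {blk} {pat} {t} net inv sim inputs initially v)
    where
    inputs : Vec (Cfg 2 2) 4
    inputs = pairCfg 0F 0F ∷ pairCfg 0F 1F ∷ pairCfg 1F 0F ∷ pairCfg 1F 1F ∷ []

    initially : Columnwise R (map (φ blk pat) inputs)
    initially w with blk w in w-block
    ... | 0F = first-cell w w-block
    ... | 1F = second-cell w w-block

  gtNetwork-cannot-simulate-xor : IsBlockEmbedding 2 2 N blk pat → ⊥
  gtNetwork-cannot-simulate-xor (_ , patterns-injective) = 0≢1+n (patterns-injective 0F 0F 1F agree)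
    where
    R₁-after : ∀ v → blk v ≡ 0F → T (R₁ (pat 0F v ∷ pat 1F v ∷ pat 1F v ∷ pat 0F v ∷ []))
    R₁-after = xor-propagates R₁-invariant (λ v _ → R₁-sstt (pat 0F v) (pat 1F v))
                                           (λ v _ → R₁-stst (pat 0F v) (pat 1F v))

    R₂-after : ∀ v → blk v ≡ 0F → T (R₂ (pat 0F v ∷ pat 1F v ∷ pat 1F v ∷ pat 0F v ∷ []))
    R₂-after = xor-propagates R₂-invariant (λ v e → R₁-stts⇒R₂-sstt (pat 0F v) (pat 1F v) (R₁-after v e))
                                           (λ v _ → R₂-stst (pat 0F v) (pat 1F v))

    agree : ∀ v → blk v ≡ 0F → pat 0F v ≡ pat 1F v
    agree v e = R₂-stts⇒≡ _ _ (R₂-after v e)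

-- The circuit inputs ws are kept apart from the gate outputs pre computed so far,
-- so that pre stays a concrete list whose entries are read off by normalisation.
data Yields (ws : List Bool) : List Bool → List Gate → List Bool → Set where
  []  : ∀ {pre} → Yields ws pre [] []
  _∷_ : ∀ {pre g gs v vs} → evalGate (ws ++ pre) g ≡ v → Yields ws (pre ∷ʳ v) gs vs →
        Yields ws pre (g ∷ gs) (v ∷ vs)

wires-yields : ∀ {ws pre gs vs} → Yields ws pre gs vs → wires (ws ++ pre) gs ≡ ws ++ pre ++ vs
wires-yields {ws} {pre} [] = cong (ws ++_) (sym (++-identityʳ pre))
wires-yields {ws} {pre} {g ∷ gs} {v ∷ vs} (evaluates ∷ rest) = begin
  wires ((ws ++ pre) ∷ʳ evalGate (ws ++ pre) g) gs  ≡⟨ cong (λ w → wires ((ws ++ pre) ∷ʳ w) gs) evaluates ⟩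
  wires ((ws ++ pre) ∷ʳ v) gs                       ≡⟨ cong (λ w → wires w gs) (++-assoc ws pre (v ∷ [])) ⟩
  wires (ws ++ (pre ∷ʳ v)) gs                       ≡⟨ wires-yields rest ⟩
  ws ++ ((pre ∷ʳ v) ++ vs)                          ≡⟨ cong (ws ++_) (++-assoc pre (v ∷ []) vs) ⟩
  ws ++ (pre ++ v ∷ vs)                             ∎

module _ {A : Set} (d : A) where

  nthD-toList : {k : ℕ} (u : Vec A k) (ys zs : List A) (i : Fin k) →
                nthD d ((toList u ++ ys) ++ zs) (toℕ i) ≡ lookup u i
  nthD-toList (a ∷ u) ys zs zero    = refl
  nthD-toList (a ∷ u) ys zs (suc i) = nthD-toList u ys zs i

  nthD-toList-shift : {k : ℕ} (u : Vec A k) (ys zs : List A) (r : ℕ) →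
                      nthD d ((toList u ++ ys) ++ zs) (k + r) ≡ nthD d (ys ++ zs) r
  nthD-toList-shift []      ys zs r = refl
  nthD-toList-shift (a ∷ u) ys zs r = nthD-toList-shift u ys zs r

  applyUpTo-nthD-shift : {k : ℕ} (u : Vec A k) (ys zs : List A) (n : ℕ) →
                         applyUpTo (λ i → nthD d ((toList u ++ ys) ++ zs) (k + i)) n
                           ≡ applyUpTo (nthD d (ys ++ zs)) n
  applyUpTo-nthD-shift []      ys zs n = refl
  applyUpTo-nthD-shift (a ∷ u) ys zs n = applyUpTo-nthD-shift u ys zs n

  applyUpTo-nthD-prefix : {k : ℕ} (u : Vec A k) (ys zs : List A) →
                          applyUpTo (nthD d ((toList u ++ ys) ++ zs)) k ≡ toList u
  applyUpTo-nthD-prefix []      ys zs = refl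
  applyUpTo-nthD-prefix (a ∷ u) ys zs = cong (a ∷_) (applyUpTo-nthD-prefix u ys zs)

differing-index : {n : ℕ} {u v : Vec Bool n} → u ≢ v → ∃ λ j → lookup u j ≢ lookup v j
differing-index {n} {u} {v} u≢v =
  ¬∀⟶∃¬ n (λ j → lookup u j ≡ lookup v j) (λ j → lookup u j Bool.≟ lookup v j) (u≢v ∘ lookups-equal)
  where
  lookups-equal : (∀ j → lookup u j ≡ lookup v j) → u ≡ v
  lookups-equal same = begin
    u                   ≡⟨ tabulate∘lookup u ⟨
    tabulate (lookup u) ≡⟨ tabulate-cong same ⟩
    tabulate (lookup v) ≡⟨ tabulate∘lookup v ⟩
    v                   ∎

≢⇒xor≡true : {a b : Bool} → a ≢ b → a xor b ≡ true
≢⇒xor≡true {false} {false} a≢b = ⊥-elim (a≢b refl)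
≢⇒xor≡true {false} {true}  _   = refl
≢⇒xor≡true {true}  {false} _   = refl
≢⇒xor≡true {true}  {true}  a≢b = ⊥-elim (a≢b refl)

module XorCircuit (k : ℕ) (u₀ u₁ : Vec Bool k) (j : Fin k) where

  K : ℕ
  K = k + k

  x y : ℕ
  x = toℕ j
  y = k + toℕ j

  wire : Fin 7 → ℕ
  wire r = K + toℕ r

  -- The gate wires carry x ∨ y, x ∧ y, ¬(x ∧ y), x xor y, ¬(x xor y), false, true.
  gates : List Gate
  gates = orG x y ∷ andG x y ∷ notG (wire (# 1)) ∷ andG (wire (# 0)) (wire (# 2))
        ∷ notG (wire (# 3)) ∷ andG (wire (# 3)) (wire (# 4)) ∷ notG (wire (# 5)) ∷ []

  codeBitWire : Bool → Bool → ℕ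
  codeBitWire false false = wire (# 5)
  codeBitWire true  true  = wire (# 6)
  codeBitWire false true  = wire (# 3)
  codeBitWire true  false = wire (# 4)

  outs : List ℕ
  outs = toList (zipWith codeBitWire u₀ u₁) ++ applyUpTo (k +_) k

  circuit : Circuit
  circuit = record { nIn = K ; gates = gates ; outs = outs }

  wire<level : {r : ℕ} (s : ℕ) → r < s → K + r < s + K
  wire<level {r} s r<s = subst (_< s + K) (+-comm r K) (+-monoˡ-< K r<s)

  gates-wf : GatesWF K gates
  gates-wf = (x<K , y<K) , (m<n⇒m<1+n x<K , m<n⇒m<1+n y<K) , wire<level 2 ≤-refl
           , (wire<level 3 z<s , wire<level 3 ≤-refl) , wire<level 4 ≤-refl
           , (wire<level 5 (n≤1+n 4) , wire<level 5 ≤-refl) , wire<level 6 ≤-refl , tt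
    where
    x<K : x < K
    x<K = <-≤-trans (toℕ<n j) (m≤m+n k k)
    y<K : y < K
    y<K = +-monoʳ-< k (toℕ<n j)

  codeBitWire-bound : ∀ a b → codeBitWire a b < K + 7
  codeBitWire-bound false false = +-monoʳ-< K (toℕ<n (# 5))
  codeBitWire-bound true  true  = +-monoʳ-< K (toℕ<n (# 6))
  codeBitWire-bound false true  = +-monoʳ-< K (toℕ<n (# 3))
  codeBitWire-bound true  false = +-monoʳ-< K (toℕ<n (# 4))

  codeBitWires-bound : {n : ℕ} (a b : Vec Bool n) → All (_< K + 7) (toList (zipWith codeBitWire a b))
  codeBitWires-bound []       []       = []
  codeBitWires-bound (a ∷ as) (b ∷ bs) = codeBitWire-bound a b ∷ codeBitWires-bound as bs

  circuit-wf : CircuitWF circuit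
  circuit-wf = gates-wf
             , ++⁺ (codeBitWires-bound u₀ u₁)
                   (applyUpTo⁺₁ (k +_) k (λ i<k → <-≤-trans (+-monoʳ-< k i<k) (m≤m+n K 7)))
             , trans (length-++ (toList (zipWith codeBitWire u₀ u₁)))
                     (cong₂ _+_ (length-toList (zipWith codeBitWire u₀ u₁)) (length-applyUpTo (k +_) k))

  select-code : (W : ℕ → Bool) (s : Bool) →
                W (wire (# 3)) ≡ s → W (wire (# 4)) ≡ not s → W (wire (# 5)) ≡ false → W (wire (# 6)) ≡ true →
                {n : ℕ} (a b : Vec Bool n) → List.map W (toList (zipWith codeBitWire a b)) ≡ toList (if s then b else a)
  select-code W true  w₃ w₄ w₅ w₆ = pick
    where
    pick : {n : ℕ} (a b : Vec Bool n) → List.map W (toList (zipWith codeBitWire a b)) ≡ toList b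
    pick []           []           = refl
    pick (false ∷ as) (false ∷ bs) = cong₂ _∷_ w₅ (pick as bs)
    pick (true  ∷ as) (true  ∷ bs) = cong₂ _∷_ w₆ (pick as bs)
    pick (false ∷ as) (true  ∷ bs) = cong₂ _∷_ w₃ (pick as bs)
    pick (true  ∷ as) (false ∷ bs) = cong₂ _∷_ w₄ (pick as bs)
  select-code W false w₃ w₄ w₅ w₆ = pick
    where
    pick : {n : ℕ} (a b : Vec Bool n) → List.map W (toList (zipWith codeBitWire a b)) ≡ toList a
    pick []           []           = refl
    pick (false ∷ as) (false ∷ bs) = cong₂ _∷_ w₅ (pick as bs)
    pick (true  ∷ as) (true  ∷ bs) = cong₂ _∷_ w₆ (pick as bs)
    pick (false ∷ as) (true  ∷ bs) = cong₂ _∷_ w₃ (pick as bs)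
    pick (true  ∷ as) (false ∷ bs) = cong₂ _∷_ w₄ (pick as bs)

  module Run (a b : Vec Bool k) where

    input : List Bool
    input = toList a ++ (toList b ++ [])

    difference : Bool
    difference = (lookup a j ∨ lookup b j) ∧ not (lookup a j ∧ lookup b j)

    values : List Bool
    values = (lookup a j ∨ lookup b j) ∷ (lookup a j ∧ lookup b j) ∷ not (lookup a j ∧ lookup b j)
           ∷ difference ∷ not difference ∷ (difference ∧ not difference) ∷ not (difference ∧ not difference) ∷ []

    read-x : ∀ pre → nthD false (input ++ pre) x ≡ lookup a j
    read-x pre = nthD-toList false a (toList b ++ []) pre j

    read-y : ∀ pre → nthD false (input ++ pre) y ≡ lookup b j
    read-y pre = trans (nthD-toList-shift false a (toList b ++ []) pre (toℕ j)) (nthD-toList false b [] pre j)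

    read-wire : ∀ pre r → nthD false (input ++ pre) (wire r) ≡ nthD false pre (toℕ r)
    read-wire pre r = begin
      nthD false (input ++ pre) (K + toℕ r)            ≡⟨ cong (nthD false (input ++ pre)) (+-assoc k k (toℕ r)) ⟩
      nthD false (input ++ pre) (k + (k + toℕ r))      ≡⟨ nthD-toList-shift false a (toList b ++ []) pre (k + toℕ r) ⟩
      nthD false ((toList b ++ []) ++ pre) (k + toℕ r) ≡⟨ nthD-toList-shift false b [] pre (toℕ r) ⟩
      nthD false pre (toℕ r)                           ∎

    gates-yield : Yields input [] gates values
    gates-yield = cong₂ _∨_ (read-x _) (read-y _) ∷ cong₂ _∧_ (read-x _) (read-y _)
                ∷ cong not (read-wire _ (# 1)) ∷ cong₂ _∧_ (read-wire _ (# 0)) (read-wire _ (# 2))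
                ∷ cong not (read-wire _ (# 3)) ∷ cong₂ _∧_ (read-wire _ (# 3)) (read-wire _ (# 4))
                ∷ cong not (read-wire _ (# 5)) ∷ []

    wires-computed : wires input gates ≡ input ++ values
    wires-computed = trans (cong (λ w → wires w gates) (sym (++-identityʳ input))) (wires-yields gates-yield)

    copies-second-cell : List.map (nthD false (input ++ values)) (applyUpTo (k +_) k) ≡ toList b ++ []
    copies-second-cell = begin
      List.map (nthD false (input ++ values)) (applyUpTo (k +_) k)
        ≡⟨ map-applyUpTo (k +_) (nthD false (input ++ values)) k ⟩
      applyUpTo (λ i → nthD false (input ++ values) (k + i)) k
        ≡⟨ applyUpTo-nthD-shift false a (toList b ++ []) values k ⟩
      applyUpTo (nthD false ((toList b ++ []) ++ values)) k
        ≡⟨ applyUpTo-nthD-prefix false b [] values ⟩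
      toList b
        ≡⟨ ++-identityʳ (toList b) ⟨
      toList b ++ []
        ∎

    evalC-circuit : evalC circuit input ≡ toList (if lookup a j xor lookup b j then u₁ else u₀) ++ (toList b ++ [])
    evalC-circuit = begin
      List.map (nthD false (wires input gates)) outs
        ≡⟨ cong (λ w → List.map (nthD false w) outs) wires-computed ⟩
      List.map W outs
        ≡⟨ map-++ W (toList (zipWith codeBitWire u₀ u₁)) (applyUpTo (k +_) k) ⟩
      List.map W (toList (zipWith codeBitWire u₀ u₁)) ++ List.map W (applyUpTo (k +_) k)
        ≡⟨ cong₂ _++_ selected copies-second-cell ⟩
      toList (if lookup a j xor lookup b j then u₁ else u₀) ++ (toList b ++ [])
        ∎
      where
      W : ℕ → Bool
      W = nthD false (input ++ values)

      selected : List.map W (toList (zipWith codeBitWire u₀ u₁)) ≡ toList (if lookup a j xor lookup b j then u₁ else u₀)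
      selected = select-code W (lookup a j xor lookup b j)
        (trans (read-wire values (# 3)) (sym (xor-is-ok (lookup a j) (lookup b j))))
        (trans (read-wire values (# 4)) (cong not (sym (xor-is-ok (lookup a j) (lookup b j)))))
        (trans (read-wire values (# 5)) (∧-inverseʳ difference))
        (trans (read-wire values (# 6)) (cong not (∧-inverseʳ difference)))
        u₀ u₁

module XorEncoding (k : ℕ → ℕ) (m : (q : ℕ) → Fin q → Vec Bool (k q))
                   (m-injective : ∀ q → Injective _≡_ _≡_ (m q)) where

  codes-differ : ∃ λ j → lookup (m 2 0F) j ≢ lookup (m 2 1F) j
  codes-differ = differing-index (0≢1+n ∘ m-injective 2)

  j : Fin (k 2)
  j = proj₁ codes-differ

  open XorCircuit (k 2) (m 2 0F) (m 2 1F) j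

  decode : ∀ a b → (if lookup (m 2 a) j xor lookup (m 2 b) j then m 2 1F else m 2 0F) ≡ m 2 (a ⊕ b)
  decode 0F 0F rewrite xor-same (lookup (m 2 0F) j) = refl
  decode 0F 1F rewrite ≢⇒xor≡true (proj₂ codes-differ) = refl
  decode 1F 0F rewrite ≢⇒xor≡true (proj₂ codes-differ ∘ sym) = refl
  decode 1F 1F rewrite xor-same (lookup (m 2 1F) j) = refl

  circuit-encodes : IsCircuitEncoding k m xorNetwork circuit
  circuit-encodes = circuit-wf , K≡k*2 , encodes
    where
    K≡k*2 : K ≡ k 2 * 2
    K≡k*2 = trans (cong (k 2 +_) (sym (+-identityʳ (k 2)))) (*-comm 2 (k 2))

    encodes : ∀ x → evalC circuit (mEnc k m x) ≡ mEnc k m (xorNetwork x)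
    encodes x = trans (Run.evalC-circuit (m 2 (x 0F)) (m 2 (x 1F)))
                      (cong (λ c → toList c ++ (toList (m 2 (x 1F)) ++ [])) (decode (x 0F) (x 1F)))

  xorNetwork-in-U : RepU k m 2 (7 ∷ []) 2 xorNetwork (enc (circTree circuit))
  xorNetwork-in-U = circuit , circuit-encodes , ≤-refl , refl

mainTheorem11 : (k : ℕ → ℕ) (m : (q : ℕ) → Fin q → Vec Bool (k q)) →
                (∀ q → Injective _≡_ _≡_ (m q)) →
                ¬ GtUniversal k m
mainTheorem11 k m m-injective universal =
  let (_ , _ , time , _ , _ , _ , simulates) = universal 2 (7 ∷ [])
      (_ , _ , _ , _ , _ , net , embedding , simulation , _) =
        simulates 2 xorNetwork _ (XorEncoding.xorNetwork-in-U k m m-injective)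
  in gtNetwork-cannot-simulate-xor {t = time 2} net simulation embedding
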